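{- There exist an infinite strictly increasing sequence of bases $(b_i)_{i\geq1}$ and an absolute constant $C>0$ such that $\overleftarrow{K}_{b_i}\geq C\log b_i$ for all $i$ (with $\overleftarrow{K}_{b_i}=\infty$ allowed). In particular $\overleftarrow{K}_{b_i}\to\infty$ as $i\to\infty$.
   Context: For a base $b\geq2$ and a positive integer $n$ with exactly $L$ base-$b$ digits, $n=\sum_{0\leq i<L}\varepsilon_i(n)b^i$ ($\varepsilon_{L-1}(n)\ne0$), its digital reverse is $\overleftarrow{n}=\sum_{0\leq i<L}\varepsilon_i(n)b^{L-1-i}$; a reversed prime in base $b$ is $\overleftarrow{p}$ for a prime $p$. Nnamlerinchs' constant $\overleftarrow{K}_b$ is the smallest integer $K>1$ such that every sufficiently large integer is a sum of at most $K$ reversed primes in base $b$ (and $\overleftarrow{K}_b=\infty$ if no such $K$ exists). -}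

module Defs where

open import Data.Nat using (ℕ; zero; suc; _+_; _*_; _^_; _≤_; _<_)
open import Data.Nat.Primality using (Prime)
open import Data.List using (List; []; _∷_; [_]; _++_; foldl; length)
open import Data.Nat.ListAction using (sum)
open import Data.List.Relation.Unary.All using (All)
open import Data.Product using (Σ; ∃; _×_)
open import Relation.Binary.PropositionalEquality using (_≡_)

valLE : ℕ → List ℕ → ℕ
valLE b []       = 0
valLE b (d ∷ ds) = d + b * valLE b ds

valBE : ℕ → List ℕ → ℕ
valBE b ds = foldl (λ acc d → acc * b + d) 0 ds

-- ds (little-endian, ds = ε₀ … ε_{L-1}) is the base-b expansion of n:
-- all digits < b, leading digit ε_{L-1} ≠ 0, and Σ εᵢ bⁱ = n.
IsDigits : ℕ → List ℕ → ℕ → Set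
IsDigits b ds n =
  All (_< b) ds × (∃ λ init → ∃ λ d → ds ≡ init ++ [ suc d ]) × valLE b ds ≡ n

IsReverse : ℕ → ℕ → ℕ → Set
IsReverse b n m = ∃ λ ds → IsDigits b ds n × valBE b ds ≡ m

IsReversedPrime : ℕ → ℕ → Set
IsReversedPrime b m = ∃ λ p → Prime p × IsReverse b p m

SumOfAtMostRevPrimes : ℕ → ℕ → ℕ → Set
SumOfAtMostRevPrimes b K n =
  ∃ λ (xs : List ℕ) → length xs ≤ K × All (IsReversedPrime b) xs × sum xs ≡ n

EveryLargeIsSum : ℕ → ℕ → Set
EveryLargeIsSum b K = ∃ λ N → ∀ n → N ≤ n → SumOfAtMostRevPrimes b K n

-- "Nnamlerinchs' constant K_b satisfies P(K_b)", for an upward-closed P, with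
-- K_b = ∞ allowed: every admissible K > 1 (in particular the smallest one,
-- K_b, if it exists) satisfies P.  If no admissible K exists (K_b = ∞) this
-- holds vacuously.
RevConstSatisfies : ℕ → (ℕ → Set) → Set
RevConstSatisfies b P = ∀ K → 1 < K → EveryLargeIsSum b K → P K

-- If every prime ≤ M divides b and M < b, the units digit e of a prime p ≥ b is
-- neither 0 (else 2 ∣ p) nor in [2, M] (else a prime factor of e divides p). That
-- digit leads the reversal, so a reversed prime at most M b^L has at most L + 1
-- digits and, when it has exactly L + 1, leading digit 1; either way it is below
-- 2 b^L, and writing M b^L as a sum of K reversed primes forces M ≤ 2K.
-- For M = 2^k take b = 2^(k+1) ∏_{j<k} C(2^(j+1), 2^j): each prime in (2^j, 2^(j+1)]
-- divides C(2^(j+1), 2^j), and b ≤ 2^(4·2^k) ≤ 2^(8K).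
module Submission where

open import Defs
open import Data.Nat
open import Data.Nat.Properties
open import Data.Nat.Divisibility
open import Data.Nat.Primality
open import Data.Nat.Primality.Factorisation using (factorise)
open import Data.Nat.Combinatorics
  using (_C_; nCk≡n!/k![n-k]!; k![n∸k]!∣n!; nCk+nC[k+1]≡[n+1]C[k+1])
open import Data.Nat.DivMod using (m/n*n≡m)
open import Data.Nat.ListAction using (sum; product)
open import Data.List using ([]; _∷_; [_]; _++_; length)
open import Data.List.Properties using (++-conicalʳ)
open import Data.List.Relation.Unary.All as All using (All; []; _∷_)
open import Data.Product using (∃; _×_; _,_)
open import Data.Sum using (inj₁; inj₂; [_,_]′)
open import Data.Empty using (⊥-elim)
open import Function using (case_of_)
open import Relation.Nullary using (yes; no; contradiction)
open import Relation.Binary.Definitions using (tri<; tri≈; tri>)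
open import Relation.Binary.PropositionalEquality
  using (_≡_; refl; sym; trans; cong; cong₂; subst; module ≡-Reasoning)

1<2 : 1 < 2
1<2 = s≤s (s≤s z≤n)

2*n≡n+n : ∀ n → 2 * n ≡ n + n
2*n≡n+n n = cong (n +_) (+-identityʳ n)

n<2^n : ∀ n → n < 2 ^ n
n<2^n zero    = z<s
n<2^n (suc n) = ≤-<-trans (n<2^n n) (^-monoʳ-< 2 1<2 (n<1+n n))

2^2^n*2^2^n≡2^2^suc-n : ∀ n → 2 ^ 2 ^ n * 2 ^ 2 ^ n ≡ 2 ^ 2 ^ suc n
2^2^n*2^2^n≡2^2^suc-n n = begin
  2 ^ 2 ^ n * 2 ^ 2 ^ n ≡⟨ sym (^-distribˡ-+-* 2 (2 ^ n) (2 ^ n)) ⟩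
  2 ^ (2 ^ n + 2 ^ n)   ≡⟨ cong (2 ^_) (sym (2*n≡n+n (2 ^ n))) ⟩
  2 ^ 2 ^ suc n         ∎
  where open ≡-Reasoning

all≤sum : ∀ xs → All (_≤ sum xs) xs
all≤sum []       = []
all≤sum (x ∷ xs) = m≤m+n x (sum xs) ∷ All.map (λ y≤ → ≤-trans y≤ (m≤n+m (sum xs) x)) (all≤sum xs)

all≤⇒sum≤length* : ∀ {B} xs → All (_≤ B) xs → sum xs ≤ length xs * B
all≤⇒sum≤length* []       []           = z≤n
all≤⇒sum≤length* (x ∷ xs) (x≤B ∷ xs≤B) = +-mono-≤ x≤B (all≤⇒sum≤length* xs xs≤B)

valBE-∷ : ∀ b d ds → valBE b (d ∷ ds) ≡ d * b ^ length ds + valBE b ds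
valBE-∷ b d []       = sym (trans (+-identityʳ (d * 1)) (*-identityʳ d))
valBE-∷ b d (e ∷ ds) = begin
  valBE b ((d * b + e) ∷ ds)         ≡⟨ valBE-∷ b (d * b + e) ds ⟩
  (d * b + e) * P + valBE b ds       ≡⟨ cong (_+ valBE b ds) (*-distribʳ-+ P (d * b) e) ⟩
  (d * b * P + e * P) + valBE b ds   ≡⟨ +-assoc (d * b * P) (e * P) (valBE b ds) ⟩
  d * b * P + (e * P + valBE b ds)   ≡⟨ cong₂ _+_ (*-assoc d b P) (sym (valBE-∷ b e ds)) ⟩
  d * (b * P) + valBE b (e ∷ ds)     ∎
  where
  open ≡-Reasoning
  P = b ^ length ds

valBE<b^length : ∀ {b} ds → All (_< b) ds → valBE b ds < b ^ length ds

valBE-∷< : ∀ {b} d ds → All (_< b) ds → valBE b (d ∷ ds) < suc d * b ^ length ds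
valBE-∷< {b} d ds ds<b = begin-strict
  valBE b (d ∷ ds)                  ≡⟨ valBE-∷ b d ds ⟩
  d * b ^ length ds + valBE b ds    <⟨ +-monoʳ-< (d * b ^ length ds) (valBE<b^length ds ds<b) ⟩
  d * b ^ length ds + b ^ length ds ≡⟨ +-comm (d * b ^ length ds) (b ^ length ds) ⟩
  suc d * b ^ length ds             ∎
  where open ≤-Reasoning

valBE<b^length []       []           = z<s
valBE<b^length (d ∷ ds) (d<b ∷ ds<b) = <-≤-trans (valBE-∷< d ds ds<b) (*-monoˡ-≤ _ d<b)

valLE-snoc>0 : ∀ {b} → 0 < b → ∀ ds d → 0 < valLE b (ds ++ [ suc d ])
valLE-snoc>0 b>0 []       d = z<s
valLE-snoc>0 b>0 (e ∷ ds) d = ≤-trans (*-mono-≤ b>0 (valLE-snoc>0 b>0 ds d)) (m≤n+m _ e)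

valLE-tail>0 : ∀ {b e rest d} → 0 < b → ∀ ds → e ∷ rest ≡ ds ++ [ suc d ] →
               0 < length rest → 0 < valLE b rest
valLE-tail>0 b>0 []       refl ()
valLE-tail>0 b>0 (_ ∷ ds) refl _ = valLE-snoc>0 b>0 ds _

prime⇒1<p : ∀ {p} → Prime p → 1 < p
prime⇒1<p {p} p-prime = nonTrivial⇒n>1 p {{prime⇒nonTrivial p-prime}}

prime⇒d∤p : ∀ {p d} → Prime p → 1 < d → d < p → d ∤ p
prime⇒d∤p p-prime 1<d d<p d∣p =
  Prime.notComposite p-prime (hasNonTrivialDivisor {{n>1⇒nonTrivial 1<d}} d<p d∣p)

∃prime∣ : ∀ {n} → 1 < n → ∃ λ p → Prime p × p ∣ n
∃prime∣ {n} 1<n with factorise n {{>-nonZero (<-trans z<s 1<n)}}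
... | record { factors = [] ; isFactorisation = n≡1 } = contradiction n≡1 (>⇒≢ 1<n)
... | record { factors = p ∷ ps ; isFactorisation = n≡p*ps ; factorsPrime = p-prime ∷ _ } =
  p , p-prime , subst (p ∣_) (sym n≡p*ps) (m∣m*n (product ps))

PrimesUpToDivide : ℕ → ℕ → Set
PrimesUpToDivide M b = ∀ {r} → Prime r → r ≤ M → r ∣ b

unitsDigitOfPrime≡1 : ∀ {M b e v} → 2 ≤ M → M < b → PrimesUpToDivide M b →
                      0 < v → e ≤ M → Prime (e + b * v) → e ≡ 1
unitsDigitOfPrime≡1 {e = 1} _ _ _ _ _ _ = refl
unitsDigitOfPrime≡1 {M} {b} {0} {v} 2≤M M<b primes∣b v>0 _ p-prime =
  contradiction (∣m⇒∣m*n v (primes∣b prime[2] 2≤M)) (prime⇒d∤p p-prime ≤-refl 2<b*v)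
  where
  2<b*v : 2 < b * v
  2<b*v = <-≤-trans (≤-<-trans 2≤M M<b) (m≤m*n b v {{>-nonZero v>0}})
unitsDigitOfPrime≡1 {M} {b} {e@(suc (suc _))} {v} 2≤M M<b primes∣b v>0 e≤M p-prime
  with ∃prime∣ {e} (s≤s (s≤s z≤n))
... | r , r-prime , r∣e =
  contradiction (∣m∣n⇒∣m+n r∣e (∣m⇒∣m*n v (primes∣b r-prime (≤-trans r≤e e≤M))))
                (prime⇒d∤p p-prime (prime⇒1<p r-prime) r<p)
  where
  r≤e : r ≤ e
  r≤e = ∣⇒≤ r∣e
  r<p : r < e + b * v
  r<p = ≤-<-trans r≤e (m<m+n e (*-mono-≤ (≤-<-trans z≤n M<b) v>0))

reversedPrime<2b^L : ∀ {M b x L} → 2 ≤ M → M < b → PrimesUpToDivide M b →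
                     IsReversedPrime b x → x ≤ M * b ^ suc L → x < 2 * b ^ suc L
reversedPrime<2b^L _ _ _ (_ , _ , [] , (_ , (ds , _ , []≡ds++) , _) , _) _ =
  contradiction (++-conicalʳ ds _ (sym []≡ds++)) λ ()
reversedPrime<2b^L {M} {b} {_} {L} 2≤M M<b primes∣b
  (_ , p-prime , e ∷ rest , (e<b ∷ rest<b , (ds , _ , digits≡ds++) , refl) , refl) x≤Mb^L =
  case <-cmp (length rest) (suc L) of λ where
    (tri< m<1+L _ _) →
      ≤-trans (<-≤-trans (valBE<b^length (e ∷ rest) (e<b ∷ rest<b)) (^-monoʳ-≤ b m<1+L))
              (m≤m+n (b ^ suc L) _)
    (tri≈ _ m≡1+L _) → begin-strict
      x                       <⟨ valBE-∷< e rest rest<b ⟩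
      suc e * b ^ length rest ≡⟨ cong₂ (λ d k → suc d * b ^ k) (e≡1 (≤-reflexive (sym m≡1+L))) m≡1+L ⟩
      2 * b ^ suc L           ∎
    (tri> _ _ 1+L<m) →
      contradiction (≤-trans (^-monoʳ-≤ b 1+L<m) (b^m≤x (<⇒≤ 1+L<m)))
                    (<⇒≱ (≤-<-trans x≤Mb^L (*-monoˡ-< (b ^ suc L) {{m^n≢0 b (suc L)}} M<b)))
  where
  open ≤-Reasoning
  b>0 : 0 < b
  b>0 = ≤-<-trans z≤n M<b
  instance
    b≢0 : NonZero b
    b≢0 = >-nonZero b>0
  x : ℕ
  x = valBE b (e ∷ rest)
  e*b^m≤x : e * b ^ length rest ≤ x
  e*b^m≤x = ≤-trans (m≤m+n _ _) (≤-reflexive (sym (valBE-∷ b e rest)))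
  e≡1 : suc L ≤ length rest → e ≡ 1
  e≡1 1+L≤m =
    unitsDigitOfPrime≡1 2≤M M<b primes∣b (valLE-tail>0 b>0 ds digits≡ds++ (≤-trans z<s 1+L≤m)) e≤M p-prime
    where
    e≤M : e ≤ M
    e≤M = *-cancelʳ-≤ e M (b ^ length rest) {{m^n≢0 b (length rest)}}
            (≤-trans e*b^m≤x (≤-trans x≤Mb^L (*-monoʳ-≤ M (^-monoʳ-≤ b 1+L≤m))))
  b^m≤x : suc L ≤ length rest → b ^ length rest ≤ x
  b^m≤x 1+L≤m = subst (_≤ x) (trans (cong (_* b ^ length rest) (e≡1 1+L≤m)) (*-identityˡ _)) e*b^m≤x

sumOfRevPrimes⇒M≤2K : ∀ {M b K L} → 2 ≤ M → M < b → PrimesUpToDivide M b →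
                       SumOfAtMostRevPrimes b K (M * b ^ suc L) → M ≤ 2 * K
sumOfRevPrimes⇒M≤2K {M} {b} {K} {L} 2≤M M<b primes∣b (xs , |xs|≤K , revPrimes , sum≡) =
  *-cancelʳ-≤ M (2 * K) (b ^ suc L) {{m^n≢0 b (suc L) {{>-nonZero (≤-<-trans z≤n M<b)}}}} (begin
    M * b ^ suc L               ≡⟨ sym sum≡ ⟩
    sum xs                      ≤⟨ all≤⇒sum≤length* xs (All.zipWith summand≤ (revPrimes , all≤sum xs)) ⟩
    length xs * (2 * b ^ suc L) ≤⟨ *-monoˡ-≤ (2 * b ^ suc L) |xs|≤K ⟩
    K * (2 * b ^ suc L)         ≡⟨ sym (*-assoc K 2 (b ^ suc L)) ⟩
    K * 2 * b ^ suc L           ≡⟨ cong (_* b ^ suc L) (*-comm K 2) ⟩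
    2 * K * b ^ suc L           ∎)
  where
  open ≤-Reasoning
  summand≤ : ∀ {x} → IsReversedPrime b x × x ≤ sum xs → x ≤ 2 * b ^ suc L
  summand≤ (x-rev , x≤sum) =
    <⇒≤ (reversedPrime<2b^L {L = L} 2≤M M<b primes∣b x-rev (≤-trans x≤sum (≤-reflexive sum≡)))

everyLargeIsSum⇒M≤2K : ∀ {M b K} → 2 ≤ M → M < b → PrimesUpToDivide M b →
                        EveryLargeIsSum b K → M ≤ 2 * K
everyLargeIsSum⇒M≤2K {M} {b} 2≤M M<b primes∣b (N , sums) =
  sumOfRevPrimes⇒M≤2K {L = N} 2≤M M<b primes∣b (sums (M * b ^ suc N) N≤Mb^N)
  where
  open ≤-Reasoning
  N≤Mb^N : N ≤ M * b ^ suc N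
  N≤Mb^N = begin
    N             ≤⟨ <⇒≤ (n<2^n N) ⟩
    2 ^ N         ≤⟨ ^-monoˡ-≤ N (≤-trans 2≤M (<⇒≤ M<b)) ⟩
    b ^ N         ≤⟨ ^-monoʳ-≤ b {{>-nonZero (≤-<-trans z≤n M<b)}} (n≤1+n N) ⟩
    b ^ suc N     ≤⟨ m≤n*m (b ^ suc N) M {{>-nonZero (≤-trans z<s 2≤M)}} ⟩
    M * b ^ suc N ∎

n!≡nCk*[k!*[n∸k]!] : ∀ {n k} → k ≤ n → n ! ≡ (n C k) * (k ! * (n ∸ k) !)
n!≡nCk*[k!*[n∸k]!] {n} {k} k≤n = sym (begin
  (n C k) * (k ! * (n ∸ k) !)                 ≡⟨ cong (_* (k ! * (n ∸ k) !)) (nCk≡n!/k![n-k]! k≤n) ⟩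
  n ! / (k ! * (n ∸ k) !) * (k ! * (n ∸ k) !) ≡⟨ m/n*n≡m (k![n∸k]!∣n! k≤n) ⟩
  n !                                         ∎)
  where
  open ≡-Reasoning
  instance
    k![n∸k]!≢0 : NonZero (k ! * (n ∸ k) !)
    k![n∸k]!≢0 = k !* (n ∸ k) !≢0

nCk≢0 : ∀ {n k} → k ≤ n → NonZero (n C k)
nCk≢0 {n} {k} k≤n = m*n≢0⇒m≢0 (n C k) {{subst NonZero (n!≡nCk*[k!*[n∸k]!] k≤n) (n !≢0)}}

nCk≤2^n : ∀ n k → n C k ≤ 2 ^ n
nCk≤2^n zero    zero    = ≤-refl
nCk≤2^n zero    (suc k) = z≤n
nCk≤2^n (suc n) zero    = ≤-trans (nCk≤2^n n zero) (m≤m+n (2 ^ n) _)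
nCk≤2^n (suc n) (suc k) = begin
  suc n C suc k     ≡⟨ sym (nCk+nC[k+1]≡[n+1]C[k+1] n k) ⟩
  n C k + n C suc k ≤⟨ +-mono-≤ (nCk≤2^n n k) (nCk≤2^n n (suc k)) ⟩
  2 ^ n + 2 ^ n     ≡⟨ sym (2*n≡n+n (2 ^ n)) ⟩
  2 ^ suc n         ∎
  where open ≤-Reasoning

m≤n⇒m∣n! : ∀ {m n} → .{{NonZero m}} → m ≤ n → m ∣ n !
m≤n⇒m∣n! {suc m} m≤n = ∣-trans (m∣m*n (m !)) (m≤n⇒m!∣n! m≤n)

prime∤m! : ∀ {p} m → Prime p → m < p → p ∤ m !
prime∤m! zero    p-prime _   p∣1  = contradiction (∣1⇒≡1 p∣1) (>⇒≢ (prime⇒1<p p-prime))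
prime∤m! (suc m) p-prime m<p p∣m! with euclidsLemma (suc m) (m !) p-prime p∣m!
... | inj₁ p∣suc-m = <⇒≱ m<p (∣⇒≤ p∣suc-m)
... | inj₂ p∣m!    = prime∤m! m p-prime (<-trans (n<1+n m) m<p) p∣m!

prime∣nCk : ∀ {p n k} → Prime p → p ≤ n → k < p → n ∸ k < p → p ∣ n C k
prime∣nCk {p} {n} {k} p-prime p≤n k<p n∸k<p
  with euclidsLemma (n C k) (k ! * (n ∸ k) !) p-prime
         (subst (p ∣_) (n!≡nCk*[k!*[n∸k]!] (<⇒≤ (<-≤-trans k<p p≤n)))
                (m≤n⇒m∣n! {{prime⇒nonZero p-prime}} p≤n))
... | inj₁ p∣nCk       = p∣nCk
... | inj₂ p∣k!*[n∸k]! = ⊥-elim ([ prime∤m! k p-prime k<p , prime∤m! (n ∸ k) p-prime n∸k<p ]′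
                                   (euclidsLemma (k !) ((n ∸ k) !) p-prime p∣k!*[n∸k]!))

centralBinomialProduct : ℕ → ℕ
centralBinomialProduct zero    = 1
centralBinomialProduct (suc k) = centralBinomialProduct k * (2 ^ suc k C 2 ^ k)

centralBinomial≢0 : ∀ k → NonZero (2 ^ suc k C 2 ^ k)
centralBinomial≢0 k = nCk≢0 (^-monoʳ-≤ 2 (n≤1+n k))

centralBinomialProduct≢0 : ∀ k → NonZero (centralBinomialProduct k)
centralBinomialProduct≢0 zero    = _
centralBinomialProduct≢0 (suc k) =
  m*n≢0 _ _ {{centralBinomialProduct≢0 k}} {{centralBinomial≢0 k}}

centralBinomialProduct≤2^2^suc : ∀ k → centralBinomialProduct k ≤ 2 ^ 2 ^ suc k
centralBinomialProduct≤2^2^suc zero    = s≤s z≤n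
centralBinomialProduct≤2^2^suc (suc k) =
  ≤-trans (*-mono-≤ (centralBinomialProduct≤2^2^suc k) (nCk≤2^n (2 ^ suc k) (2 ^ k)))
          (≤-reflexive (2^2^n*2^2^n≡2^2^suc-n (suc k)))

primesUpTo2^k∣centralBinomialProduct : ∀ k → PrimesUpToDivide (2 ^ k) (centralBinomialProduct k)
primesUpTo2^k∣centralBinomialProduct zero r-prime r≤1 = contradiction r≤1 (<⇒≱ (prime⇒1<p r-prime))
primesUpTo2^k∣centralBinomialProduct (suc k) {r} r-prime r≤2^suc-k with r ≤? 2 ^ k
... | yes r≤2^k = ∣m⇒∣m*n _ (primesUpTo2^k∣centralBinomialProduct k r-prime r≤2^k)
... | no  r≰2^k = ∣n⇒∣m*n (centralBinomialProduct k)
                    (prime∣nCk r-prime r≤2^suc-k 2^k<r (subst (_< r) (sym 2^suc-k∸2^k≡2^k) 2^k<r))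
  where
  2^k<r : 2 ^ k < r
  2^k<r = ≰⇒> r≰2^k
  2^suc-k∸2^k≡2^k : 2 ^ suc k ∸ 2 ^ k ≡ 2 ^ k
  2^suc-k∸2^k≡2^k = trans (cong (_∸ 2 ^ k) (2*n≡n+n (2 ^ k))) (m+n∸m≡n (2 ^ k) (2 ^ k))

hardBase : ℕ → ℕ
hardBase k = 2 ^ suc k * centralBinomialProduct k

primesUpTo2^k∣hardBase : ∀ k → PrimesUpToDivide (2 ^ k) (hardBase k)
primesUpTo2^k∣hardBase k r-prime r≤2^k =
  ∣n⇒∣m*n (2 ^ suc k) (primesUpTo2^k∣centralBinomialProduct k r-prime r≤2^k)

2^k<hardBase : ∀ k → 2 ^ k < hardBase k
2^k<hardBase k =
  <-≤-trans (^-monoʳ-< 2 1<2 (n<1+n k)) (m≤m*n _ _ {{centralBinomialProduct≢0 k}})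

hardBase-strictlyIncreasing : ∀ k → hardBase k < hardBase (suc k)
hardBase-strictlyIncreasing k = begin-strict
  2 ^ suc k * centralBinomialProduct k
    <⟨ *-monoˡ-< _ {{centralBinomialProduct≢0 k}} (^-monoʳ-< 2 1<2 (n<1+n (suc k))) ⟩
  2 ^ suc (suc k) * centralBinomialProduct k
    ≤⟨ *-monoʳ-≤ (2 ^ suc (suc k)) (m≤m*n _ _ {{centralBinomial≢0 k}}) ⟩
  2 ^ suc (suc k) * centralBinomialProduct (suc k) ∎
  where open ≤-Reasoning

hardBase≤2^8K : ∀ {k K} → 2 ^ k ≤ 2 * K → hardBase k ≤ 2 ^ (8 * K)
hardBase≤2^8K {k} {K} 2^k≤2K = begin
  2 ^ suc k * centralBinomialProduct k
    ≤⟨ *-mono-≤ (^-monoʳ-≤ 2 (<⇒≤ (n<2^n (suc k)))) (centralBinomialProduct≤2^2^suc k) ⟩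
  2 ^ 2 ^ suc k * 2 ^ 2 ^ suc k ≡⟨ 2^2^n*2^2^n≡2^2^suc-n (suc k) ⟩
  2 ^ 2 ^ suc (suc k)           ≡⟨ cong (2 ^_) (sym (*-assoc 2 2 (2 ^ k))) ⟩
  2 ^ (4 * 2 ^ k)               ≤⟨ ^-monoʳ-≤ 2 (*-monoʳ-≤ 4 2^k≤2K) ⟩
  2 ^ (4 * (2 * K))             ≡⟨ cong (2 ^_) (sym (*-assoc 4 2 K)) ⟩
  2 ^ (8 * K)                   ∎
  where open ≤-Reasoning

theorem6p5 : ∃ λ (b : ℕ → ℕ) → (2 ≤ b 0 × (∀ i → b i < b (suc i)))
    × ∃ λ (q : ℕ) → 1 ≤ q
    × (∀ i → RevConstSatisfies (b i) (λ K → b i ≤ 2 ^ (q * K)))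
theorem6p5 =
  (λ i → hardBase (suc i)) , (<⇒≤ (2^k<hardBase 1) , λ i → hardBase-strictlyIncreasing (suc i)) ,
  8 , s≤s z≤n ,
  λ i K _ sums → hardBase≤2^8K {suc i} {K} (everyLargeIsSum⇒M≤2K (^-monoʳ-≤ 2 (s≤s (z≤n {i})))
                   (2^k<hardBase (suc i)) (primesUpTo2^k∣hardBase (suc i)) sums)
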